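{- If $G$ and $H$ are nontrivial, connected graphs with girth at least $4$ such that $G \Box H$ is well-covered, then at least one of $G$ or $H$ is (isomorphic to) the graph $K_2$.
   Context: All graphs are finite and simple; "nontrivial" means having at least two vertices. A graph is well-covered if all its maximal independent sets have the same cardinality. The girth of a graph is the length of its shortest cycle ($\infty$ for forests). The Cartesian product $G \Box H$ has vertex set $V(G)\times V(H)$, with $(g_1,h_1)$ adjacent to $(g_2,h_2)$ if either $g_1=g_2$ and $h_1h_2\in E(H)$, or $h_1=h_2$ and $g_1g_2\in E(G)$. -}

module Defs where

open import Data.Nat using (ℕ; suc; _+_; _≤_; _<_)
open import Data.Bool using (Bool; true; false; _∧_; _∨_)
open import Data.Fin using (Fin; zero; suc; inject₁; fromℕ; remQuot; _≟_)
open import Data.Fin.Subset using (Subset; _∈_; _∉_; ∣_∣)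
open import Data.Product using (Σ; ∃; _×_; _,_; proj₁; proj₂)
open import Relation.Binary.PropositionalEquality using (_≡_; _≢_)
open import Relation.Nullary using (¬_)
open import Relation.Nullary.Decidable using (⌊_⌋)
open import Function.Bundles using (_↔_; Inverse)
open import Function.Definitions using (Injective)

record Graph : Set where
  field
    order : ℕ
    adj   : Fin order → Fin order → Bool
open Graph public

record IsSimple (G : Graph) : Set where
  field
    adj-sym    : ∀ u v → adj G u v ≡ adj G v u
    adj-irrefl : ∀ u → adj G u u ≡ false

Nontrivial : Graph → Set
Nontrivial G = 2 ≤ order G

data Reachable (G : Graph) (u : Fin (order G)) : Fin (order G) → Set where
  here : Reachable G u u
  step : ∀ {v w} → Reachable G u v → adj G v w ≡ true → Reachable G u w

Connected : Graph → Set
Connected G = ∀ u v → Reachable G u v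

record Cycle (G : Graph) (m : ℕ) : Set where
  field
    vtx    : Fin (3 + m) → Fin (order G)
    inj    : Injective _≡_ _≡_ vtx
    consec : ∀ (i : Fin (2 + m)) → adj G (vtx (inject₁ i)) (vtx (suc i)) ≡ true
    close  : adj G (vtx (fromℕ (2 + m))) (vtx zero) ≡ true

-- girth(G) ≥ g : G has no cycle of length < g (vacuous for forests, girth ∞).
GirthAtLeast : ℕ → Graph → Set
GirthAtLeast g G = ∀ m → 3 + m < g → ¬ Cycle G m

Independent : (G : Graph) → Subset (order G) → Set
Independent G S = ∀ u v → u ∈ S → v ∈ S → adj G u v ≡ false

MaximalIndependent : (G : Graph) → Subset (order G) → Set
MaximalIndependent G S =
  Independent G S × (∀ v → v ∉ S → ∃ λ u → u ∈ S × adj G u v ≡ true)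

WellCovered : Graph → Set
WellCovered G = ∀ S T → MaximalIndependent G S → MaximalIndependent G T → ∣ S ∣ ≡ ∣ T ∣

_□_ : Graph → Graph → Graph
G □ H = record
  { order = Data.Nat._*_ (order G) (order H)
  ; adj   = λ i j → let (g₁ , h₁) = remQuot (order H) i
                        (g₂ , h₂) = remQuot (order H) j
                    in (⌊ g₁ ≟ g₂ ⌋ ∧ adj H h₁ h₂) ∨ (⌊ h₁ ≟ h₂ ⌋ ∧ adj G g₁ g₂)
  }

K₂ : Graph
K₂ = record { order = 2 ; adj = λ u v → Relation.Nullary.Decidable.⌊ Relation.Nullary.Decidable.¬? (u ≟ v) ⌋ }

record _≅_ (G H : Graph) : Set where
  field
    bij      : Fin (order G) ↔ Fin (order H)
    preserve : ∀ u v → adj H (Inverse.to bij u) (Inverse.to bij v) ≡ adj G u v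

-- A connected nontrivial simple graph other than K₂ contains a path g – g₁ – g₂, g ≠ g₂.
-- Take such paths in G and in H, y – y₁ – y₂. With N the neighbourhoods, the set
--   X = {(g,y)} ∪ (N(g₁) ∖ {g}) × N(y) ∪ N(g) × (N(y₁) ∖ {y})
-- is independent in G □ H because G and H are triangle-free, and it dominates every
-- neighbour of (g₁,y) and of (g,y₁) other than (g,y). So in a maximal independent set
-- P ⊇ X one may replace (g,y) by the nonadjacent vertices (g₁,y) and (g,y₁); the result
-- is independent, and extending it gives a maximal independent set larger than P.

module Submission where

open import Defs
open import Data.Bool using (Bool; true; false; _∧_; _∨_)
open import Data.Bool.Properties using (¬-not; not-¬; ∨-zeroʳ)
import Data.Bool.Properties as Bool
open import Data.Empty using (⊥-elim)
open import Data.Fin using (Fin; zero; suc; combine; remQuot; _≟_)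
open import Data.Fin.Properties using (any?; remQuot-combine; combine-remQuot)
open import Data.Fin.Subset
  using (Subset; _∈_; _∉_; _⊆_; _⊂_; _∪_; _─_; _-_; ⁅_⁆; ∣_∣; inside; outside)
open import Data.Fin.Subset.Properties
  using (_∈?_; ∣p∣≤n; p⊆q⇒∣p∣≤∣q∣; p⊂q⇒∣p∣<∣q∣; p⊆p∪q; x∈p∪q⁺; x∈p∪q⁻; x∈⁅x⁆; x∈⁅y⁆⇒x≡y; p─q⊆p; p─⊥≡p)
open import Data.Nat using (ℕ; suc; _+_; _≤_; _<_; s≤s)
open import Data.Nat.Properties using (≤-refl; <-≤-trans; ≤-reflexive; ≤-trans; n≤1+n; <⇒≱; +-suc; +-monoʳ-≤; m≤m+n; module ≤-Reasoning)
open import Data.Product using (Σ; ∃; ∃-syntax; _×_; _,_; proj₁; proj₂; uncurry)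
open import Data.Sum using (_⊎_; inj₁; inj₂; [_,_]′; map; map₂)
open import Data.Vec using (_∷_; tabulate)
open import Data.Vec.Base using (here; there)
open import Data.Vec.Properties using (lookup⇒[]=; []=⇒lookup; lookup∘tabulate)
open import Function using (_∘_; id)
open import Function.Bundles using (mk⇔; mk↔ₛ′)
open import Relation.Binary.PropositionalEquality
  using (_≡_; _≢_; refl; sym; trans; cong; cong₂; subst)
open import Relation.Nullary using (¬_; Dec; yes; no; ¬?; contradiction; does)
open import Relation.Nullary.Decidable
  using (⌊_⌋; _×-dec_; _⊎-dec_; map′; decidable-stable; dec-true; does-⇔; isYes≗does)

private
  variable
    n : ℕ

x∈p─q⇒x∉q : ∀ (p q : Subset n) {x} → x ∈ p ─ q → x ∉ q
x∈p─q⇒x∉q (_ ∷ p) (outside ∷ q) here        ()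
x∈p─q⇒x∉q (_ ∷ p) (outside ∷ q) (there x∈) (there x∈q) = x∈p─q⇒x∉q p q x∈ x∈q
x∈p─q⇒x∉q (_ ∷ p) (inside  ∷ q) (there x∈) (there x∈q) = x∈p─q⇒x∉q p q x∈ x∈q

x∈p-y⇒x≢y : ∀ (p : Subset n) {x y} → x ∈ p - y → x ≢ y
x∈p-y⇒x≢y p {y = y} x∈ refl = x∈p─q⇒x∉q p ⁅ y ⁆ x∈ (x∈⁅x⁆ y)

∣p∣≤1+∣p-x∣ : ∀ (p : Subset n) x → ∣ p ∣ ≤ suc ∣ p - x ∣
∣p∣≤1+∣p-x∣ (inside  ∷ p) zero    = s≤s (≤-reflexive (cong ∣_∣ (sym (p─⊥≡p p))))
∣p∣≤1+∣p-x∣ (outside ∷ p) zero    = ≤-trans (≤-reflexive (cong ∣_∣ (sym (p─⊥≡p p)))) (n≤1+n _)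
∣p∣≤1+∣p-x∣ (inside  ∷ p) (suc x) = s≤s (∣p∣≤1+∣p-x∣ p x)
∣p∣≤1+∣p-x∣ (outside ∷ p) (suc x) = ∣p∣≤1+∣p-x∣ p x

p⊂p∪⁅x⁆ : ∀ {p : Subset n} {x} → x ∉ p → p ⊂ p ∪ ⁅ x ⁆
p⊂p∪⁅x⁆ {p = p} {x} x∉p = p⊆p∪q {p = p} ⁅ x ⁆ , x , x∈p∪q⁺ (inj₂ (x∈⁅x⁆ x)) , x∉p

fromDec : {P : Fin n → Set} → (∀ x → Dec (P x)) → Subset n
fromDec P? = tabulate (does ∘ P?)

∈-fromDec⁺ : ∀ {P : Fin n → Set} (P? : ∀ x → Dec (P x)) {x} → P x → x ∈ fromDec P?
∈-fromDec⁺ P? {x} p = lookup⇒[]= x _ (trans (lookup∘tabulate _ x) (dec-true (P? x) p))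

∈-fromDec⁻ : ∀ {P : Fin n → Set} (P? : ∀ x → Dec (P x)) {x} → x ∈ fromDec P? → P x
∈-fromDec⁻ P? {x} x∈ with P? x | trans (sym (lookup∘tabulate (does ∘ P?) x)) ([]=⇒lookup x∈)
... | yes p | _ = p
... | no _  | ()

IndependentPred : (G : Graph) → (Fin (order G) → Set) → Set
IndependentPred G P = ∀ u v → P u → P v → adj G u v ≡ false

NeighbourIn : (G : Graph) → Subset (order G) → Fin (order G) → Set
NeighbourIn G S v = ∃ λ u → u ∈ S × adj G u v ≡ true

TriangleFree : Graph → Set
TriangleFree G = ∀ x → IndependentPred G (λ u → adj G x u ≡ true)

module _ {G : Graph} where

  neighbourIn? : ∀ S u → Dec (NeighbourIn G S u)
  neighbourIn? S u = any? (λ s → (s ∈? S) ×-dec (adj G s u Bool.≟ true))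

  independentPred-⊆ : ∀ {P Q : Fin (order G) → Set} → (∀ {x} → P x → Q x) →
                      IndependentPred G Q → IndependentPred G P
  independentPred-⊆ P⊆Q Q-ind u v Pu Pv = Q-ind u v (P⊆Q Pu) (P⊆Q Pv)

  module _ (G-simple : IsSimple G) where
    open IsSimple G-simple

    independentPred-≡ : ∀ w → IndependentPred G (_≡ w)
    independentPred-≡ w u .u refl refl = adj-irrefl u

    independentPred-⊎ : ∀ {P Q : Fin (order G) → Set} →
                        IndependentPred G P → IndependentPred G Q →
                        (∀ u v → P u → Q v → adj G u v ≡ false) →
                        IndependentPred G (λ x → P x ⊎ Q x)
    independentPred-⊎ P-ind Q-ind P≁Q u v (inj₁ Pu) (inj₁ Pv) = P-ind u v Pu Pv
    independentPred-⊎ P-ind Q-ind P≁Q u v (inj₁ Pu) (inj₂ Qv) = P≁Q u v Pu Qv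
    independentPred-⊎ P-ind Q-ind P≁Q u v (inj₂ Qu) (inj₁ Pv) = trans (adj-sym u v) (P≁Q v u Pv Qu)
    independentPred-⊎ P-ind Q-ind P≁Q u v (inj₂ Qu) (inj₂ Qv) = Q-ind u v Qu Qv

    independent-∪⁅⁆ : ∀ {S w} → Independent G S → (∀ u → u ∈ S → adj G u w ≡ false) →
                      Independent G (S ∪ ⁅ w ⁆)
    independent-∪⁅⁆ {S} {w} S-ind S≁w =
      independentPred-⊆ (λ {x} x∈ → map₂ (x∈⁅y⁆⇒x≡y w) (x∈p∪q⁻ S ⁅ w ⁆ x∈))
        (independentPred-⊎ S-ind (independentPred-≡ w) (λ { u _ u∈S refl → S≁w u u∈S }))

    extendToMaximal : ∀ S → Independent G S → ∃[ M ] S ⊆ M × MaximalIndependent G M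
    extendToMaximal S₀ S₀-ind = grow (order G) S₀ (m≤m+n _ _) S₀-ind
      where
      -- k bounds the number of vertices that can still be added to S.
      grow : ∀ k S → order G ≤ k + ∣ S ∣ → Independent G S →
             ∃[ M ] S ⊆ M × MaximalIndependent G M
      grow k S room S-ind with any? (λ u → ¬? ((u ∈? S) ⊎-dec neighbourIn? S u))
      ... | no all-dominated = S , id , S-ind , dominated
        where
        dominated : ∀ u → u ∉ S → NeighbourIn G S u
        dominated u u∉S with decidable-stable ((u ∈? S) ⊎-dec neighbourIn? S u)
                               (λ u-free → all-dominated (u , u-free))
        ... | inj₁ u∈S = contradiction u∈S u∉S
        ... | inj₂ nb  = nb
      ... | yes (u , u-free) = larger k room
        where
        S⊂S′ : S ⊂ S ∪ ⁅ u ⁆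
        S⊂S′ = p⊂p∪⁅x⁆ (u-free ∘ inj₁)
        S′-ind : Independent G (S ∪ ⁅ u ⁆)
        S′-ind = independent-∪⁅⁆ S-ind (λ s s∈S → ¬-not (λ s~u → u-free (inj₂ (s , s∈S , s~u))))
        more-room : ∀ k → suc k + ∣ S ∣ ≤ k + ∣ S ∪ ⁅ u ⁆ ∣
        more-room k = subst (_≤ k + ∣ S ∪ ⁅ u ⁆ ∣) (+-suc k ∣ S ∣) (+-monoʳ-≤ k (p⊂q⇒∣p∣<∣q∣ S⊂S′))
        larger : ∀ k → order G ≤ k + ∣ S ∣ → ∃[ M ] S ⊆ M × MaximalIndependent G M
        larger 0       room′ = ⊥-elim (<⇒≱ (p⊂q⇒∣p∣<∣q∣ S⊂S′) (≤-trans (∣p∣≤n (S ∪ ⁅ u ⁆)) room′))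
        larger (suc k) room′
          with grow k (S ∪ ⁅ u ⁆) (≤-trans room′ (more-room k)) S′-ind
        ... | M , S′⊆M , M-max = M , (λ x∈S → S′⊆M (proj₁ S⊂S′ x∈S)) , M-max

-- v ∈ X can be traded for t₁ and t₂ in every independent superset of X.
record Exchange (G : Graph) : Set where
  field
    X             : Subset (order G)
    X-independent : Independent G X
    v t₁ t₂       : Fin (order G)
    v∈X           : v ∈ X
    v~t₁          : adj G v t₁ ≡ true
    v~t₂          : adj G v t₂ ≡ true
    t₁≁t₂         : adj G t₁ t₂ ≡ false
    t₁≢t₂         : t₁ ≢ t₂
    X-dominates   : ∀ u → u ≢ v → adj G t₁ u ≡ true ⊎ adj G t₂ u ≡ true → NeighbourIn G X u

module _ {G : Graph} (G-simple : IsSimple G) (e : Exchange G) where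
  open IsSimple G-simple
  open Exchange e

  exchange : ∀ P → X ⊆ P → Independent G P → ∃[ P′ ] Independent G P′ × ∣ P ∣ < ∣ P′ ∣
  exchange P X⊆P P-ind = R ∪ ⁅ t₂ ⁆ , P′-ind , ∣P∣<∣P′∣
    where
    t∉P : ∀ {t} → adj G v t ≡ true → t ∉ P
    t∉P v~t t∈P = contradiction (trans (sym v~t) (P-ind v _ (X⊆P v∈X) t∈P)) λ ()

    P-v≁ : ∀ t → (∀ {u} → adj G t u ≡ true → adj G t₁ u ≡ true ⊎ adj G t₂ u ≡ true) →
           ∀ u → u ∈ P - v → adj G u t ≡ false
    P-v≁ t t~⇒ u u∈ = ¬-not λ u~t →
      let (x , x∈X , x~u) = X-dominates u (x∈p-y⇒x≢y P u∈) (t~⇒ (trans (adj-sym t u) u~t))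
      in contradiction (trans (sym x~u) (P-ind x u (X⊆P x∈X) (p─q⊆p P ⁅ v ⁆ u∈))) λ ()

    R : Subset (order G)
    R = (P - v) ∪ ⁅ t₁ ⁆

    R≁t₂ : ∀ u → u ∈ R → adj G u t₂ ≡ false
    R≁t₂ u u∈R with x∈p∪q⁻ (P - v) ⁅ t₁ ⁆ u∈R
    ... | inj₁ u∈P-v  = P-v≁ t₂ inj₂ u u∈P-v
    ... | inj₂ u∈⁅t₁⁆ rewrite x∈⁅y⁆⇒x≡y t₁ u∈⁅t₁⁆ = t₁≁t₂

    t₂∉R : t₂ ∉ R
    t₂∉R t₂∈R with x∈p∪q⁻ (P - v) ⁅ t₁ ⁆ t₂∈R
    ... | inj₁ t₂∈P-v  = t∉P v~t₂ (p─q⊆p P ⁅ v ⁆ t₂∈P-v)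
    ... | inj₂ t₂∈⁅t₁⁆ = t₁≢t₂ (sym (x∈⁅y⁆⇒x≡y t₁ t₂∈⁅t₁⁆))

    P′-ind : Independent G (R ∪ ⁅ t₂ ⁆)
    P′-ind = independent-∪⁅⁆ G-simple
      (independent-∪⁅⁆ G-simple (λ x y x∈ y∈ → P-ind x y (p─q⊆p P ⁅ v ⁆ x∈) (p─q⊆p P ⁅ v ⁆ y∈))
                                (P-v≁ t₁ inj₁))
      R≁t₂

    ∣P∣<∣P′∣ : ∣ P ∣ < ∣ R ∪ ⁅ t₂ ⁆ ∣
    ∣P∣<∣P′∣ = begin-strict
      ∣ P ∣          ≤⟨ ∣p∣≤1+∣p-x∣ P v ⟩
      suc ∣ P - v ∣  <⟨ s≤s (p⊂q⇒∣p∣<∣q∣ (p⊂p∪⁅x⁆ (t∉P v~t₁ ∘ p─q⊆p P ⁅ v ⁆))) ⟩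
      suc ∣ R ∣      ≤⟨ p⊂q⇒∣p∣<∣q∣ (p⊂p∪⁅x⁆ t₂∉R) ⟩
      ∣ R ∪ ⁅ t₂ ⁆ ∣ ∎
      where open ≤-Reasoning

wellCovered⇒¬Exchange : ∀ {G} → IsSimple G → WellCovered G → ¬ Exchange G
wellCovered⇒¬Exchange G-simple wc e
  with extendToMaximal G-simple (Exchange.X e) (Exchange.X-independent e)
... | P , X⊆P , P-max with exchange G-simple e P X⊆P (proj₁ P-max)
... | P′ , P′-ind , ∣P∣<∣P′∣ with extendToMaximal G-simple P′ P′-ind
... | Q , P′⊆Q , Q-max =
  <⇒≱ (<-≤-trans ∣P∣<∣P′∣ (p⊆q⇒∣p∣≤∣q∣ P′⊆Q)) (≤-reflexive (wc Q P Q-max P-max))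

module _ {G : Graph} (G-simple : IsSimple G) where
  open IsSimple G-simple

  ~-sym : ∀ {u v} → adj G u v ≡ true → adj G v u ≡ true
  ~-sym {u} {v} u~v = trans (adj-sym v u) u~v

  adjacent⇒≢ : ∀ {u v} → adj G u v ≡ true → u ≢ v
  adjacent⇒≢ {u} u~v refl = contradiction (trans (sym u~v) (adj-irrefl u)) λ ()

  triangle : ∀ {x a b} → adj G x a ≡ true → adj G a b ≡ true → adj G b x ≡ true → Cycle G 0
  triangle {x} {a} {b} x~a a~b b~x = record
    { vtx    = vtx
    ; inj    = inj
    ; consec = λ { zero → x~a ; (suc zero) → a~b }
    ; close  = b~x
    }
    where
    vtx : Fin 3 → Fin (order G)
    vtx zero             = x
    vtx (suc zero)       = a
    vtx (suc (suc zero)) = b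
    x≢a : x ≢ a
    x≢a = adjacent⇒≢ x~a
    a≢b : a ≢ b
    a≢b = adjacent⇒≢ a~b
    b≢x : b ≢ x
    b≢x = adjacent⇒≢ b~x
    inj : ∀ {i j} → vtx i ≡ vtx j → i ≡ j
    inj {zero}             {zero}             _ = refl
    inj {suc zero}         {suc zero}         _ = refl
    inj {suc (suc zero)}   {suc (suc zero)}   _ = refl
    inj {zero}             {suc zero}         e = contradiction e x≢a
    inj {zero}             {suc (suc zero)}   e = contradiction (sym e) b≢x
    inj {suc zero}         {zero}             e = contradiction (sym e) x≢a
    inj {suc zero}         {suc (suc zero)}   e = contradiction e a≢b
    inj {suc (suc zero)}   {zero}             e = contradiction e b≢x
    inj {suc (suc zero)}   {suc zero}         e = contradiction (sym e) a≢b

  girth≥4⇒triangleFree : GirthAtLeast 4 G → TriangleFree G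
  girth≥4⇒triangleFree girth x a b x~a x~b = ¬-not λ a~b →
    girth 0 ≤-refl (triangle x~a a~b (~-sym x~b))

record Path₃ (G : Graph) : Set where
  constructor path₃
  field
    x₀ x₁ x₂ : Fin (order G)
    x₀~x₁    : adj G x₀ x₁ ≡ true
    x₁~x₂    : adj G x₁ x₂ ≡ true
    x₀≢x₂    : x₀ ≢ x₂

path₃? : ∀ G → Dec (Path₃ G)
path₃? G = map′ (λ (a , b , c , a~b , b~c , a≢c) → path₃ a b c a~b b~c a≢c)
                (λ (path₃ a b c a~b b~c a≢c) → a , b , c , a~b , b~c , a≢c)
                (any? λ a → any? λ b → any? λ c →
                   (adj G a b Bool.≟ true) ×-dec (adj G b c Bool.≟ true) ×-dec ¬? (a ≟ c))

¬path₃⇒reachable⇒≡⊎adjacent : ∀ {G} → ¬ Path₃ G →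
                               ∀ {u w} → Reachable G u w → w ≡ u ⊎ adj G u w ≡ true
¬path₃⇒reachable⇒≡⊎adjacent ¬p here = inj₁ refl
¬path₃⇒reachable⇒≡⊎adjacent ¬p {u} (step {v} {w} r v~w)
  with ¬path₃⇒reachable⇒≡⊎adjacent ¬p r
... | inj₁ refl = inj₂ v~w
... | inj₂ u~v  = inj₁ (sym (decidable-stable (u ≟ w) (¬p ∘ path₃ u v w u~v v~w)))

twoVertices : 2 ≤ n → Σ (Fin n) λ a → Σ (Fin n) λ b → a ≢ b
twoVertices {suc (suc n)} _         = zero , suc zero , λ ()
twoVertices {suc 0}       (s≤s ())

connected⇒path₃⊎≅K₂ : ∀ {G} → IsSimple G → Nontrivial G → Connected G → Path₃ G ⊎ G ≅ K₂
connected⇒path₃⊎≅K₂ {G} G-simple nontrivial connected with path₃? G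
... | yes p = inj₁ p
... | no ¬p = inj₂ (record { bij = mk↔ₛ′ to from to∘from from∘to ; preserve = preserve })
  where
  open IsSimple G-simple
  z w : Fin (order G)
  z = proj₁ (twoVertices nontrivial)
  w = proj₁ (proj₂ (twoVertices nontrivial))

  z~ : ∀ {u} → u ≢ z → adj G z u ≡ true
  z~ {u} u≢z = [ (λ u≡z → contradiction u≡z u≢z) , id ]′
                 (¬path₃⇒reachable⇒≡⊎adjacent ¬p (connected z u))

  w≢z : w ≢ z
  w≢z w≡z = proj₂ (proj₂ (twoVertices nontrivial)) (sym w≡z)

  ≡w : ∀ {u} → u ≢ z → u ≡ w
  ≡w {u} u≢z = decidable-stable (u ≟ w)
    (λ u≢w → ¬p (path₃ u z w (~-sym G-simple (z~ u≢z)) (z~ w≢z) u≢w))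

  to : Fin (order G) → Fin 2
  to u with u ≟ z
  ... | yes _ = zero
  ... | no _  = suc zero

  from : Fin 2 → Fin (order G)
  from zero       = z
  from (suc zero) = w

  to∘from : ∀ i → to (from i) ≡ i
  to∘from zero with z ≟ z
  ... | yes _   = refl
  ... | no z≢z  = contradiction refl z≢z
  to∘from (suc zero) with w ≟ z
  ... | yes w≡z = contradiction w≡z w≢z
  ... | no _    = refl

  from∘to : ∀ u → from (to u) ≡ u
  from∘to u with u ≟ z
  ... | yes u≡z = sym u≡z
  ... | no u≢z  = sym (≡w u≢z)

  preserve : ∀ u v → adj K₂ (to u) (to v) ≡ adj G u v
  preserve u v with u ≟ z | v ≟ z
  ... | yes refl | yes refl = sym (adj-irrefl u)
  ... | yes refl | no v≢z   = sym (z~ v≢z)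
  ... | no u≢z   | yes refl = sym (~-sym G-simple (z~ u≢z))
  ... | no u≢z   | no v≢z   rewrite ≡w u≢z | ≡w v≢z = sym (adj-irrefl w)

⌊⌋-true : ∀ {P : Set} (P? : Dec P) → P → ⌊ P? ⌋ ≡ true
⌊⌋-true P? p = trans (isYes≗does P?) (dec-true P? p)

⌊≟⌋-sym : ∀ (a b : Fin n) → ⌊ a ≟ b ⌋ ≡ ⌊ b ≟ a ⌋
⌊≟⌋-sym a b = trans (isYes≗does (a ≟ b))
                (trans (does-⇔ (mk⇔ sym sym) (a ≟ b) (b ≟ a)) (sym (isYes≗does (b ≟ a))))

module Product (G H : Graph) where

  Coord : Set
  Coord = Fin (order G) × Fin (order H)

  ⟪_⟫ : Fin (order (G □ H)) → Coord
  ⟪_⟫ = remQuot (order H)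

  ⟦_⟧ : Coord → Fin (order (G □ H))
  ⟦_⟧ = uncurry combine

  ⟪⟦_⟧⟫ : ∀ p → ⟪ ⟦ p ⟧ ⟫ ≡ p
  ⟪⟦ a , b ⟧⟫ = remQuot-combine a b

  ⟦⟪_⟫⟧ : ∀ u → ⟦ ⟪ u ⟫ ⟧ ≡ u
  ⟦⟪ u ⟫⟧ = combine-remQuot {order G} (order H) u

  -- adj (G □ H) u w is definitionally adjᶜ ⟪ u ⟫ ⟪ w ⟫.
  adjᶜ : Coord → Coord → Bool
  adjᶜ (a , b) (a′ , b′) = (⌊ a ≟ a′ ⌋ ∧ adj H b b′) ∨ (⌊ b ≟ b′ ⌋ ∧ adj G a a′)

  _∼_ : Coord → Coord → Set
  (a , b) ∼ (a′ , b′) = (a ≡ a′ × adj H b b′ ≡ true) ⊎ (b ≡ b′ × adj G a a′ ≡ true)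

  adj-⟦⟧ˡ : ∀ p u → adj (G □ H) ⟦ p ⟧ u ≡ adjᶜ p ⟪ u ⟫
  adj-⟦⟧ˡ p u = cong (λ q → adjᶜ q ⟪ u ⟫) ⟪⟦ p ⟧⟫

  adj-⟦⟧ : ∀ p q → adj (G □ H) ⟦ p ⟧ ⟦ q ⟧ ≡ adjᶜ p q
  adj-⟦⟧ p q = cong₂ adjᶜ ⟪⟦ p ⟧⟫ ⟪⟦ q ⟧⟫

  adjᶜ⇒∼ : ∀ p q → adjᶜ p q ≡ true → p ∼ q
  adjᶜ⇒∼ (a , b) (a′ , b′) e with a ≟ a′ | b ≟ b′ | adj H b b′ | adj G a a′
  ... | yes a≡a′ | _        | true  | _     = inj₁ (a≡a′ , refl)
  ... | _        | yes b≡b′ | _     | true  = inj₂ (b≡b′ , refl)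
  ... | yes _    | yes _    | false | false = contradiction e λ ()
  ... | yes _    | no _     | false | _     = contradiction e λ ()
  ... | no _     | yes _    | _     | false = contradiction e λ ()
  ... | no _     | no _     | _     | _     = contradiction e λ ()

  ∼⇒adjᶜ : ∀ p q → p ∼ q → adjᶜ p q ≡ true
  ∼⇒adjᶜ (a , b) (a , b′) (inj₁ (refl , b~b′)) rewrite ⌊⌋-true (a ≟ a) refl | b~b′ = refl
  ∼⇒adjᶜ (a , b) (a′ , b) (inj₂ (refl , a~a′)) rewrite ⌊⌋-true (b ≟ b) refl | a~a′ = ∨-zeroʳ _

  ⟦⟧-injective : ∀ {p q} → ⟦ p ⟧ ≡ ⟦ q ⟧ → p ≡ q
  ⟦⟧-injective {p} {q} e = trans (sym ⟪⟦ p ⟧⟫) (trans (cong ⟪_⟫ e) ⟪⟦ q ⟧⟫)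

  ×-independent : ∀ {S T} → IndependentPred G S → IndependentPred H T →
                  IndependentPred (G □ H) (λ u → S (proj₁ ⟪ u ⟫) × T (proj₂ ⟪ u ⟫))
  ×-independent S-ind T-ind u w (Sa , Tb) (Sa′ , Tb′) = ¬-not (¬∼ ∘ adjᶜ⇒∼ ⟪ u ⟫ ⟪ w ⟫)
    where
    ¬∼ : ¬ ⟪ u ⟫ ∼ ⟪ w ⟫
    ¬∼ (inj₁ (_ , b~b′)) = not-¬ b~b′ (T-ind _ _ Tb Tb′)
    ¬∼ (inj₂ (_ , a~a′)) = not-¬ a~a′ (S-ind _ _ Sa Sa′)

  module _ (G-simple : IsSimple G) (H-simple : IsSimple H) where
    private
      module G = IsSimple G-simple
      module H = IsSimple H-simple

    ∼-irrefl : ∀ p → ¬ p ∼ p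
    ∼-irrefl (a , b) (inj₁ (_ , b~b)) = adjacent⇒≢ H-simple b~b refl
    ∼-irrefl (a , b) (inj₂ (_ , a~a)) = adjacent⇒≢ G-simple a~a refl

    □-simple : IsSimple (G □ H)
    □-simple = record
      { adj-sym    = λ u w → let (a , b) = ⟪ u ⟫; (a′ , b′) = ⟪ w ⟫ in
                     cong₂ _∨_ (cong₂ _∧_ (⌊≟⌋-sym a a′) (H.adj-sym b b′))
                               (cong₂ _∧_ (⌊≟⌋-sym b b′) (G.adj-sym a a′))
      ; adj-irrefl = λ u → ¬-not (∼-irrefl ⟪ u ⟫ ∘ adjᶜ⇒∼ ⟪ u ⟫ ⟪ u ⟫)
      }

    module _ (G-triangleFree : TriangleFree G) (H-triangleFree : TriangleFree H) where

      □-exchange : Path₃ G → Path₃ H → Exchange (G □ H)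
      □-exchange (path₃ g g₁ g₂ g~g₁ g₁~g₂ g≢g₂) (path₃ y y₁ y₂ y~y₁ y₁~y₂ y≢y₂) = record
        { X             = fromDec InX?
        ; X-independent = independentPred-⊆ (∈-fromDec⁻ InX?) X-independent
        ; v             = v
        ; t₁            = ⟦ g₁ , y ⟧
        ; t₂            = ⟦ g , y₁ ⟧
        ; v∈X           = ∈-fromDec⁺ InX? (inj₁ refl)
        ; v~t₁          = trans (adj-⟦⟧ _ _) (∼⇒adjᶜ _ _ (inj₂ (refl , g~g₁)))
        ; v~t₂          = trans (adj-⟦⟧ _ _) (∼⇒adjᶜ _ _ (inj₁ (refl , y~y₁)))
        ; t₁≁t₂         = trans (adj-⟦⟧ _ _) (¬-not (t₁≁t₂ ∘ adjᶜ⇒∼ _ _))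
        ; t₁≢t₂         = adjacent⇒≢ G-simple g~g₁ ∘ sym ∘ cong proj₁ ∘ ⟦⟧-injective
        ; X-dominates   = dominates
        }
        where
        v : Fin (order (G □ H))
        v = ⟦ g , y ⟧

        A B : Coord → Set
        A (a , b) = (adj G g₁ a ≡ true × a ≢ g) × adj H y b ≡ true
        B (a , b) = adj G g a ≡ true × (adj H y₁ b ≡ true × b ≢ y)

        A? : ∀ p → Dec (A p)
        A? (a , b) = ((adj G g₁ a Bool.≟ true) ×-dec ¬? (a ≟ g)) ×-dec (adj H y b Bool.≟ true)
        B? : ∀ p → Dec (B p)
        B? (a , b) = (adj G g a Bool.≟ true) ×-dec ((adj H y₁ b Bool.≟ true) ×-dec ¬? (b ≟ y))

        InX : Fin (order (G □ H)) → Set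
        InX u = u ≡ v ⊎ A ⟪ u ⟫ ⊎ B ⟪ u ⟫

        InX? : ∀ u → Dec (InX u)
        InX? u = (u ≟ v) ⊎-dec A? ⟪ u ⟫ ⊎-dec B? ⟪ u ⟫

        A≁B : ∀ {p q} → A p → B q → ¬ p ∼ q
        A≁B ((g₁~a , _) , _) (g~a , _) (inj₁ (refl , _)) = not-¬ g₁~a (G-triangleFree g g₁ _ g~g₁ g~a)
        A≁B (_ , y~b) (_ , y₁~b , _)   (inj₂ (refl , _)) = not-¬ y₁~b (H-triangleFree y y₁ _ y~y₁ y~b)

        v≁A⊎B : ∀ {q} → A q ⊎ B q → ¬ (g , y) ∼ q
        v≁A⊎B (inj₁ ((_ , a≢g) , _)) (inj₁ (g≡a , _)) = a≢g (sym g≡a)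
        v≁A⊎B (inj₁ (_ , y~b))        (inj₂ (refl , _)) = adjacent⇒≢ H-simple y~b refl
        v≁A⊎B (inj₂ (g~a , _))        (inj₁ (refl , _)) = adjacent⇒≢ G-simple g~a refl
        v≁A⊎B (inj₂ (_ , _ , b≢y))    (inj₂ (y≡b , _)) = b≢y (sym y≡b)

        X-independent : IndependentPred (G □ H) InX
        X-independent =
          independentPred-⊎ □-simple (independentPred-≡ □-simple v)
            (independentPred-⊎ □-simple
              (×-independent (independentPred-⊆ {P = λ a → adj G g₁ a ≡ true × a ≢ g} proj₁ (G-triangleFree g₁))
                             (H-triangleFree y))
              (×-independent (G-triangleFree g)
                             (independentPred-⊆ {P = λ b → adj H y₁ b ≡ true × b ≢ y} proj₁ (H-triangleFree y₁)))
              (λ u w Au Bw → ¬-not (A≁B Au Bw ∘ adjᶜ⇒∼ _ _)))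
            (λ { u w refl A⊎Bw → trans (adj-⟦⟧ˡ _ w) (¬-not (v≁A⊎B A⊎Bw ∘ adjᶜ⇒∼ _ _)) })

        t₁≁t₂ : ¬ (g₁ , y) ∼ (g , y₁)
        t₁≁t₂ (inj₁ (g₁≡g , _)) = adjacent⇒≢ G-simple g~g₁ (sym g₁≡g)
        t₁≁t₂ (inj₂ (y≡y₁ , _)) = adjacent⇒≢ H-simple y~y₁ y≡y₁

        dominator : ∀ q → q ≢ (g , y) → (g₁ , y) ∼ q ⊎ (g , y₁) ∼ q → ∃ λ p → (A p ⊎ B p) × p ∼ q
        dominator (_ , b) _ (inj₁ (inj₁ (refl , y~b))) =
          (g₂ , b) , inj₁ ((g₁~g₂ , g≢g₂ ∘ sym) , y~b) , inj₂ (refl , ~-sym G-simple g₁~g₂)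
        dominator (a , _) q≢v (inj₁ (inj₂ (refl , g₁~a))) =
          (a , y₁) , inj₁ ((g₁~a , q≢v ∘ cong (_, y)) , y~y₁) , inj₁ (refl , ~-sym H-simple y~y₁)
        dominator (_ , b) q≢v (inj₂ (inj₁ (refl , y₁~b))) =
          (g₁ , b) , inj₂ (g~g₁ , y₁~b , q≢v ∘ cong (g ,_)) , inj₂ (refl , ~-sym G-simple g~g₁)
        dominator (a , _) _ (inj₂ (inj₂ (refl , g~a))) =
          (a , y₂) , inj₂ (g~a , y₁~y₂ , y≢y₂ ∘ sym) , inj₁ (refl , ~-sym H-simple y₁~y₂)

        dominates : ∀ u → u ≢ v → adj (G □ H) ⟦ g₁ , y ⟧ u ≡ true ⊎ adj (G □ H) ⟦ g , y₁ ⟧ u ≡ true →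
                    NeighbourIn (G □ H) (fromDec InX?) u
        dominates u u≢v t~u
          with dominator ⟪ u ⟫ (λ e → u≢v (trans (sym ⟦⟪ u ⟫⟧) (cong ⟦_⟧ e)))
                 (map (to-∼ _) (to-∼ _) t~u)
          where
          to-∼ : ∀ p → adj (G □ H) ⟦ p ⟧ u ≡ true → p ∼ ⟪ u ⟫
          to-∼ p p~u = adjᶜ⇒∼ _ _ (trans (sym (adj-⟦⟧ˡ p u)) p~u)
        ... | p , A⊎Bp , p∼u =
          ⟦ p ⟧ , ∈-fromDec⁺ InX? (inj₂ (subst (λ q → A q ⊎ B q) (sym ⟪⟦ p ⟧⟫) A⊎Bp))
                , trans (adj-⟦⟧ˡ p u) (∼⇒adjᶜ _ _ p∼u)

corollary3p6 : (G H : Graph) → IsSimple G → IsSimple H →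
    Nontrivial G → Nontrivial H → Connected G → Connected H →
    GirthAtLeast 4 G → GirthAtLeast 4 H → WellCovered (G □ H) →
    (G ≅ K₂) ⊎ (H ≅ K₂)
corollary3p6 G H G-simple H-simple G-nontrivial H-nontrivial G-connected H-connected G-girth H-girth wc
  with connected⇒path₃⊎≅K₂ G-simple G-nontrivial G-connected
     | connected⇒path₃⊎≅K₂ H-simple H-nontrivial H-connected
... | inj₂ G≅K₂ | _         = inj₁ G≅K₂
... | inj₁ _    | inj₂ H≅K₂ = inj₂ H≅K₂
... | inj₁ G-path | inj₁ H-path =
  ⊥-elim (wellCovered⇒¬Exchange (□-simple G-simple H-simple) wc
           (□-exchange G-simple H-simple (girth≥4⇒triangleFree G-simple G-girth)
                                         (girth≥4⇒triangleFree H-simple H-girth) G-path H-path))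
  where open Product G H
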